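{- Let $n\ge 3$ be odd. Then $$V(2,n)=V\left(\tfrac{n+1}{2},n\right)=\begin{cases}(3n-3)/4, & n\equiv 1\pmod 4,\\ (3n-5)/4, & n\equiv 3\pmod 4,\end{cases}$$ and $$V\left(\tfrac{n-1}{2},n\right)=V(n-2,n)=\frac{n+1}{2}.$$
   Context: For integers $1\le a<n$ with $\gcd(a,n)=1$, $P_{a,n}=\{t_1(1,0)+t_2(a,n) : 0\le t_1,t_2\le 1\}$. A lattice point $(u_1,u_2)\in\mathbb{Z}^2$ is visible if $\gcd(u_1,u_2)=1$, and $V(a,n)$ is the number of visible lattice points in the interior of $P_{a,n}$. -}

module Defs where

open import Data.Nat using (ℕ; _+_; _*_; _<_; _<?_)
open import Data.Nat.GCD using (gcd)
open import Data.Nat.Properties using (_≟_)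
open import Data.List using (List; length; filter; upTo; cartesianProduct)
open import Data.Product using (_×_; _,_)
open import Relation.Binary.PropositionalEquality using (_≡_)
open import Relation.Nullary.Decidable using (Dec; _×-dec_)

-- A lattice point (u₁,u₂) lies in the interior of
-- P_{a,n} = { t₁(1,0) + t₂(a,n) : 0 ≤ t₁,t₂ ≤ 1 }
-- iff  u = t₁(1,0)+t₂(a,n) with 0 < t₁ < 1, 0 < t₂ < 1, i.e.
-- t₂ = u₂/n ∈ (0,1) and t₁ = (n u₁ - a u₂)/n ∈ (0,1), i.e.
--   0 < u₂ < n   and   a u₂ < n u₁ < a u₂ + n .
-- (For a ≥ 1 such points have u₁,u₂ > 0, so it suffices to range over ℕ.)
InInterior : ℕ → ℕ → ℕ × ℕ → Set
InInterior a n (u₁ , u₂) =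
  (0 < u₂) × (u₂ < n) × (a * u₂ < n * u₁) × (n * u₁ < a * u₂ + n)

Visible : ℕ × ℕ → Set
Visible (u₁ , u₂) = gcd u₁ u₂ ≡ 1

VisibleInterior : ℕ → ℕ → ℕ × ℕ → Set
VisibleInterior a n u = InInterior a n u × Visible u

visibleInterior? : (a n : ℕ) (u : ℕ × ℕ) → Dec (VisibleInterior a n u)
visibleInterior? a n (u₁ , u₂) =
  ((0 <? u₂) ×-dec ((u₂ <? n) ×-dec ((a * u₂ <? n * u₁) ×-dec (n * u₁ <? a * u₂ + n))))
  ×-dec (gcd u₁ u₂ ≟ 1)

-- Every interior point satisfies u₁ ≤ a and u₂ < n (since n u₁ < a u₂ + n < a n + n),
-- so the box [0,a] × [0,n-1] contains all of them.
box : ℕ → ℕ → List (ℕ × ℕ)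
box a n = cartesianProduct (upTo (a + 1)) (upTo n)

V : ℕ → ℕ → ℕ
V a n = length (filter (visibleInterior? a n) (box a n))

-- On the line u₂ = y (0 < y < n) the interior of P_{a,n} is the open segment
-- a y / n < u₁ < a y / n + 1. When gcd(a,n) = 1 the endpoints are not integers, so the
-- line carries exactly one interior lattice point, (⌊a y / n⌋ + 1, y), and V(a,n) is the
-- number of rows y for which this point is visible. For n = 2m + 1 the abscissa is
-- explicit: for a = 2 it is 1 or 2 according as 2y < n or not; for a = m + 1 it is j + 1
-- on row 2j + 1 and j + 2 on row 2j + 2; for a = m it is j + 1 on both rows 2j + 1 and
-- 2j + 2; for a = n − 2 it is y on the rows y ≤ m and y − 1 above. Visibility then comes
-- down to a parity condition or to the abscissa being 1, and the counts follow.

module Submission where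

open import Defs
open import Data.Nat using (ℕ; zero; suc; _+_; _*_; _∸_; _/_; _%_; _≤_; _<_; z≤n; s≤s; z<s; s<s; s≤s⁻¹; NonZero; >-nonZero; ⌊_/2⌋)
open import Data.Nat.Properties
open import Data.List using (List; _++_; length; filter; map; applyUpTo; upTo; cartesianProduct)
open import Data.List.Properties using (length-++; filter-++)
open import Data.Product using (_×_; _,_; proj₁; proj₂)
open import Data.Nat.Divisibility using (_∣_; ∣-refl; m∣m*n; ∣⇒≤; m%n≡0⇒n∣m; n∣m*n; ∣1⇒≡1; ∣m+n∣m⇒∣n; ∣m⇒∣m*n)
open import Data.Nat.Coprimality using (Coprime; 1-coprimeTo; coprime?; coprime-divisor; coprime⇒gcd≡1; gcd≡1⇒coprime) renaming (sym to coprime-sym)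
open import Data.Nat.DivMod using (m≡m%n+[m/n]*n; m%n<n; +-distrib-/-∣ʳ; m<n⇒m/n≡0; m*n/n≡m; m<n*o⇒m/o<n; m≥n⇒m/n>0; /-congˡ; [m+kn]%n≡m%n)
open import Data.Nat.Tactic.RingSolver using (solve-∀)
open import Function using (id; _∘_)
open import Relation.Nullary using (Dec; yes; no; ¬_; contradiction)
open import Relation.Binary.PropositionalEquality
open import Algebra.Properties.CommutativeSemigroup +-commutativeSemigroup using (interchange)

∑ : ℕ → (ℕ → ℕ) → ℕ
∑ zero    f = 0
∑ (suc n) f = f 0 + ∑ n (f ∘ suc)

syntax ∑ n (λ i → e) = ∑[ i < n ] e

∑-cong : ∀ n {f g : ℕ → ℕ} → (∀ i → i < n → f i ≡ g i) → ∑ n f ≡ ∑ n g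
∑-cong zero    f≗g = refl
∑-cong (suc n) f≗g = cong₂ _+_ (f≗g 0 z<s) (∑-cong n (λ i i<n → f≗g (suc i) (s<s i<n)))

∑-const : ∀ n {f : ℕ → ℕ} {c} → (∀ i → i < n → f i ≡ c) → ∑ n f ≡ n * c
∑-const zero    f≡c = refl
∑-const (suc n) f≡c = cong₂ _+_ (f≡c 0 z<s) (∑-const n (λ i i<n → f≡c (suc i) (s<s i<n)))

∑-zero : ∀ n {f : ℕ → ℕ} → (∀ i → i < n → f i ≡ 0) → ∑ n f ≡ 0
∑-zero n f≡0 = trans (∑-const n f≡0) (*-zeroʳ n)

∑-ones : ∀ n {f : ℕ → ℕ} → (∀ i → i < n → f i ≡ 1) → ∑ n f ≡ n
∑-ones n f≡1 = trans (∑-const n f≡1) (*-identityʳ n)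

∑-distrib-+ : ∀ n (f g : ℕ → ℕ) → ∑[ i < n ] (f i + g i) ≡ ∑ n f + ∑ n g
∑-distrib-+ zero    f g = refl
∑-distrib-+ (suc n) f g =
  trans (cong (f 0 + g 0 +_) (∑-distrib-+ n (f ∘ suc) (g ∘ suc))) (interchange (f 0) (g 0) _ _)

∑-swap : ∀ m n (h : ℕ → ℕ → ℕ) → ∑[ i < m ] ∑[ j < n ] h i j ≡ ∑[ j < n ] ∑[ i < m ] h i j
∑-swap zero    n h = sym (∑-zero n (λ _ _ → refl))
∑-swap (suc m) n h =
  trans (cong (∑ n (h 0) +_) (∑-swap m n (h ∘ suc))) (sym (∑-distrib-+ n (h 0) _))

∑-split : ∀ c r (f : ℕ → ℕ) → ∑ (c + r) f ≡ ∑ c f + ∑[ i < r ] f (c + i)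
∑-split zero    r f = refl
∑-split (suc c) r f = trans (cong (f 0 +_) (∑-split c r (f ∘ suc))) (sym (+-assoc (f 0) _ _))

∑-single : ∀ n (f : ℕ → ℕ) k → k < n → (∀ i → i < n → i ≢ k → f i ≡ 0) → ∑ n f ≡ f k
∑-single (suc n) f zero    _         others =
  trans (cong (f 0 +_) (∑-zero n (λ i i<n → others (suc i) (s<s i<n) λ ()))) (+-identityʳ (f 0))
∑-single (suc n) f (suc k) (s<s k<n) others = cong₂ _+_ (others 0 z<s λ ())
  (∑-single n (f ∘ suc) k k<n (λ i i<n i≢k → others (suc i) (s<s i<n) (i≢k ∘ suc-injective)))

∑-prefix : ∀ n (f : ℕ → ℕ) c → c ≤ n →
           (∀ i → i < c → f i ≡ 1) → (∀ i → c ≤ i → i < n → f i ≡ 0) → ∑ n f ≡ c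
∑-prefix n       f zero    _         _    zeros = ∑-zero n (λ i → zeros i z≤n)
∑-prefix (suc n) f (suc c) (s≤s c≤n) ones zeros = cong₂ _+_ (ones 0 z<s)
  (∑-prefix n (f ∘ suc) c c≤n (λ i i<c → ones (suc i) (s<s i<c))
                              (λ i c≤i i<n → zeros (suc i) (s≤s c≤i) (s<s i<n)))

∑-pairs : ∀ m (f : ℕ → ℕ) → ∑ (m * 2) f ≡ ∑[ j < m ] (f (j * 2) + f (suc (j * 2)))
∑-pairs zero    f = refl
∑-pairs (suc m) f =
  trans (cong (λ s → f 0 + (f 1 + s)) (∑-pairs m (f ∘ suc ∘ suc))) (sym (+-assoc (f 0) (f 1) _))

∑-alternating : ∀ m (f : ℕ → ℕ) → (∀ i → i * 2 < m → f (i * 2) ≡ 0) →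
                (∀ i → suc (i * 2) < m → f (suc (i * 2)) ≡ 1) → ∑ m f ≡ ⌊ m /2⌋
∑-alternating zero          f evens odds = refl
∑-alternating (suc zero)    f evens odds = cong (_+ 0) (evens 0 z<s)
∑-alternating (suc (suc m)) f evens odds = cong₂ _+_ (evens 0 z<s) (cong₂ _+_ (odds 0 (s<s z<s))
  (∑-alternating m (f ∘ suc ∘ suc) (λ i lt → evens (suc i) (s<s (s<s lt)))
                                   (λ i lt → odds (suc i) (s<s (s<s lt)))))

indicator : ∀ {P : Set} → Dec P → ℕ
indicator (yes _) = 1
indicator (no _)  = 0

indicator-yes : ∀ {P : Set} (P? : Dec P) → P → indicator P? ≡ 1
indicator-yes (yes _) _ = refl
indicator-yes (no ¬p) p = contradiction p ¬p

indicator-no : ∀ {P : Set} (P? : Dec P) → ¬ P → indicator P? ≡ 0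
indicator-no (yes p) ¬p = contradiction p ¬p
indicator-no (no _)  _  = refl

indicator-cong : ∀ {P Q : Set} (P? : Dec P) (Q? : Dec Q) → (P → Q) → (Q → P) →
                 indicator P? ≡ indicator Q?
indicator-cong (yes _) (yes _) _  _    = refl
indicator-cong (yes p) (no ¬q) to _    = contradiction (to p) ¬q
indicator-cong (no ¬p) (yes q) _  from = contradiction (from q) ¬p
indicator-cong (no _)  (no _)  _  _    = refl

count-map-applyUpTo : ∀ {A B : Set} {P : A → Set} (P? : ∀ x → Dec (P x)) (g : B → A) (f : ℕ → B) n →
                      length (filter P? (map g (applyUpTo f n))) ≡ ∑[ i < n ] indicator (P? (g (f i)))
count-map-applyUpTo P? g f zero = refl
count-map-applyUpTo P? g f (suc n) with P? (g (f 0))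
... | yes _ = cong suc (count-map-applyUpTo P? g (f ∘ suc) n)
... | no _  = count-map-applyUpTo P? g (f ∘ suc) n

count-cartesianProduct : ∀ {B C : Set} {P : B × C → Set} (P? : ∀ u → Dec (P u))
                         (f : ℕ → B) m (ys : List C) →
                         length (filter P? (cartesianProduct (applyUpTo f m) ys)) ≡
                         ∑[ i < m ] length (filter P? (map (f i ,_) ys))
count-cartesianProduct P? f zero    ys = refl
count-cartesianProduct P? f (suc m) ys = begin
  length (filter P? (map (f 0 ,_) ys ++ cartesianProduct (applyUpTo (f ∘ suc) m) ys))
    ≡⟨ cong length (filter-++ P? (map (f 0 ,_) ys) _) ⟩
  length (filter P? (map (f 0 ,_) ys) ++ filter P? (cartesianProduct (applyUpTo (f ∘ suc) m) ys))
    ≡⟨ length-++ (filter P? (map (f 0 ,_) ys)) ⟩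
  length (filter P? (map (f 0 ,_) ys)) + length (filter P? (cartesianProduct (applyUpTo (f ∘ suc) m) ys))
    ≡⟨ cong (length (filter P? (map (f 0 ,_) ys)) +_) (count-cartesianProduct P? (f ∘ suc) m ys) ⟩
  ∑[ i < suc m ] length (filter P? (map (f i ,_) ys)) ∎
  where open ≡-Reasoning

rowCount : ℕ → ℕ → ℕ → ℕ
rowCount a n y = ∑[ x < a + 1 ] indicator (visibleInterior? a n (x , y))

V≡∑rowCount : ∀ a n → V a n ≡ ∑[ y < n ] rowCount a n y
V≡∑rowCount a n = begin
  V a n
    ≡⟨ count-cartesianProduct (visibleInterior? a n) id (a + 1) (upTo n) ⟩
  ∑[ x < a + 1 ] length (filter (visibleInterior? a n) (map (x ,_) (upTo n)))
    ≡⟨ ∑-cong (a + 1) (λ x _ → count-map-applyUpTo (visibleInterior? a n) (x ,_) id n) ⟩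
  ∑[ x < a + 1 ] ∑[ y < n ] indicator (visibleInterior? a n (x , y))
    ≡⟨ ∑-swap (a + 1) n _ ⟩
  ∑[ y < n ] rowCount a n y ∎
  where open ≡-Reasoning


*-<-window : ∀ {L n x x′} → n * x < L + n → L < n * x′ → x ≤ x′
*-<-window {L} {n} {x} {x′} nx<L+n L<nx′ = s≤s⁻¹ (*-cancelˡ-< n x (suc x′) (begin-strict
  n * x       <⟨ nx<L+n ⟩
  L + n       <⟨ +-monoˡ-< n L<nx′ ⟩
  n * x′ + n  ≡⟨ +-comm (n * x′) n ⟩
  n + n * x′  ≡⟨ *-suc n x′ ⟨
  n * suc x′  ∎))
  where open ≤-Reasoning

interior-unique : ∀ {a n x x′ y} → InInterior a n (x , y) → InInterior a n (x′ , y) → x ≡ x′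
interior-unique (_ , _ , ay<nx , nx<ay+n) (_ , _ , ay<nx′ , nx′<ay+n) =
  ≤-antisym (*-<-window nx<ay+n ay<nx′) (*-<-window nx′<ay+n ay<nx)

interior-bounded : ∀ {a n x y} → InInterior a n (x , y) → x ≤ a
interior-bounded {a} {n} {x} {y} (_ , y<n , _ , nx<ay+n) = s≤s⁻¹ (*-cancelˡ-< n x (suc a) (begin-strict
  n * x      <⟨ nx<ay+n ⟩
  a * y + n  ≤⟨ +-monoˡ-≤ n (*-monoʳ-≤ a (<⇒≤ y<n)) ⟩
  a * n + n  ≡⟨ cong₂ _+_ (*-comm a n) refl ⟩
  n * a + n  ≡⟨ +-comm (n * a) n ⟩
  n + n * a  ≡⟨ *-suc n a ⟨
  n * suc a  ∎))
  where open ≤-Reasoning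

remainder-nonzero : ∀ {a n y} .{{_ : NonZero n}} → Coprime n a → 0 < y → y < n → 0 < a * y % n
remainder-nonzero {a} {n} {y} n⊥a 0<y y<n with a * y % n in eq
... | suc _ = z<s
... | zero  = contradiction n≤y (<⇒≱ y<n)
  where
  n≤y : n ≤ y
  n≤y = ∣⇒≤ {{>-nonZero 0<y}} (coprime-divisor n⊥a (m%n≡0⇒n∣m (a * y) n eq))

floor-interior : ∀ {a n y} .{{_ : NonZero n}} → Coprime n a → 0 < y → y < n →
                 InInterior a n (suc (a * y / n) , y)
floor-interior {a} {n} {y} n⊥a 0<y y<n = 0<y , y<n , ay<nx , nx<ay+n
  where
  open ≤-Reasoning
  q = a * y / n
  r = a * y % n
  ay≡r+qn : a * y ≡ r + q * n
  ay≡r+qn = m≡m%n+[m/n]*n (a * y) n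
  nx≡qn+n : n * suc q ≡ q * n + n
  nx≡qn+n = trans (*-suc n q) (trans (+-comm n (n * q)) (cong (_+ n) (*-comm n q)))
  ay<nx : a * y < n * suc q
  ay<nx = begin-strict
    a * y      ≡⟨ ay≡r+qn ⟩
    r + q * n  <⟨ +-monoˡ-< (q * n) (m%n<n (a * y) n) ⟩
    n + q * n  ≡⟨ +-comm n (q * n) ⟩
    q * n + n  ≡⟨ nx≡qn+n ⟨
    n * suc q  ∎
  nx<ay+n : n * suc q < a * y + n
  nx<ay+n = begin-strict
    n * suc q      ≡⟨ nx≡qn+n ⟩
    q * n + n      <⟨ +-monoˡ-< n (m<n+m (q * n) (remainder-nonzero n⊥a 0<y y<n)) ⟩
    r + q * n + n  ≡⟨ cong (_+ n) ay≡r+qn ⟨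
    a * y + n      ∎

indicator-visible≡indicator-coprime : ∀ {a n x y} → InInterior a n (x , y) →
                                      (P? : Dec (VisibleInterior a n (x , y))) →
                                      indicator P? ≡ indicator (coprime? x y)
indicator-visible≡indicator-coprime {x = x} {y} ii P? =
  indicator-cong P? (coprime? x y) (gcd≡1⇒coprime ∘ proj₂) (λ x⊥y → ii , coprime⇒gcd≡1 x⊥y)

rowCount-interior : ∀ {a n x y} → InInterior a n (x , y) → rowCount a n y ≡ indicator (coprime? x y)
rowCount-interior {a} {n} {x} {y} ii = begin
  rowCount a n y
    ≡⟨ ∑-single (a + 1) _ x (≤-<-trans (interior-bounded ii) (m<m+n a z<s)) others ⟩
  indicator (visibleInterior? a n (x , y))
    ≡⟨ indicator-visible≡indicator-coprime {a} {n} ii (visibleInterior? a n (x , y)) ⟩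
  indicator (coprime? x y) ∎
  where
  open ≡-Reasoning
  others : ∀ x′ → x′ < a + 1 → x′ ≢ x → indicator (visibleInterior? a n (x′ , y)) ≡ 0
  others x′ _ x′≢x =
    indicator-no (visibleInterior? a n (x′ , y)) (λ (ii′ , _) → x′≢x (interior-unique {a} {n} ii′ ii))

visibleRow : (a n : ℕ) .{{_ : NonZero n}} → ℕ → ℕ
visibleRow a n y = indicator (coprime? (suc (a * y / n)) y)

V≡∑visibleRow : ∀ a n → Coprime (suc n) a → V a (suc n) ≡ ∑[ y < n ] visibleRow a (suc n) (suc y)
V≡∑visibleRow a n n⊥a = begin
  V a (suc n)                                                 ≡⟨ V≡∑rowCount a (suc n) ⟩
  rowCount a (suc n) 0 + ∑[ y < n ] rowCount a (suc n) (suc y) ≡⟨ cong₂ _+_ row₀ rows ⟩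
  ∑[ y < n ] visibleRow a (suc n) (suc y)                      ∎
  where
  open ≡-Reasoning
  row₀ : rowCount a (suc n) 0 ≡ 0
  row₀ = ∑-zero (a + 1) (λ x _ → indicator-no (visibleInterior? a (suc n) (x , 0)) λ { ((() , _) , _) })
  rows : ∑[ y < n ] rowCount a (suc n) (suc y) ≡ ∑[ y < n ] visibleRow a (suc n) (suc y)
  rows = ∑-cong n (λ y y<n → rowCount-interior {a} (floor-interior {a} n⊥a z<s (s<s y<n)))

V≡odd-rows+even-rows : ∀ a m → Coprime (suc (m * 2)) a →
                       V a (suc (m * 2)) ≡ ∑[ j < m ] visibleRow a (suc (m * 2)) (suc (j * 2))
                                         + ∑[ j < m ] visibleRow a (suc (m * 2)) (suc j * 2)
V≡odd-rows+even-rows a m n⊥a = begin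
  V a (suc (m * 2))                          ≡⟨ V≡∑visibleRow a (m * 2) n⊥a ⟩
  ∑[ y < m * 2 ] visibleRow a n (suc y)      ≡⟨ ∑-pairs m (visibleRow a n ∘ suc) ⟩
  ∑[ j < m ] (visibleRow a n (suc (j * 2)) + visibleRow a n (suc j * 2))
                                             ≡⟨ ∑-distrib-+ m _ _ ⟩
  ∑[ j < m ] visibleRow a n (suc (j * 2)) + ∑[ j < m ] visibleRow a n (suc j * 2) ∎
  where
  open ≡-Reasoning
  n = suc (m * 2)

m≡r+q*n⇒m/n≡q : ∀ {m n q r} .{{_ : NonZero n}} → m ≡ r + q * n → r < n → m / n ≡ q
m≡r+q*n⇒m/n≡q {m} {n} {q} {r} refl r<n = begin
  (r + q * n) / n     ≡⟨ +-distrib-/-∣ʳ r (n∣m*n q) ⟩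
  r / n + q * n / n   ≡⟨ cong₂ _+_ (m<n⇒m/n≡0 r<n) (m*n/n≡m q n) ⟩
  q                   ∎
  where open ≡-Reasoning

visibleRow-by-quotient : ∀ {a n y} .{{_ : NonZero n}} {q} → a * y / n ≡ q →
                         visibleRow a n y ≡ indicator (coprime? (suc q) y)
visibleRow-by-quotient {y = y} = cong (λ q → indicator (coprime? (suc q) y))

visibleRow-by-division : ∀ {a n y} .{{_ : NonZero n}} q r → a * y ≡ r + q * n → r < n →
                         visibleRow a n y ≡ indicator (coprime? (suc q) y)
visibleRow-by-division {a} q r ay≡r+qn r<n = visibleRow-by-quotient {a} (m≡r+q*n⇒m/n≡q ay≡r+qn r<n)

Bézout⇒coprime : ∀ {m n} p q → m * p ≡ n * q + 1 → Coprime m n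
Bézout⇒coprime p q mp≡nq+1 {d} (d∣m , d∣n) =
  ∣1⇒≡1 (∣m+n∣m⇒∣n (subst (d ∣_) mp≡nq+1 (∣m⇒∣m*n p d∣m)) (∣m⇒∣m*n q d∣n))

common-factor⇒¬coprime : ∀ {m n d} → 1 < d → d ∣ m → d ∣ n → ¬ Coprime m n
common-factor⇒¬coprime 1<d d∣m d∣n m⊥n = >⇒≢ 1<d (m⊥n (d∣m , d∣n))

coprime[1+j,1+2j] : ∀ j → Coprime (suc j) (suc (j * 2))
coprime[1+j,1+2j] j = Bézout⇒coprime 2 1 (bézout j)
  where
  bézout : ∀ j → suc j * 2 ≡ suc (j * 2) * 1 + 1
  bézout = solve-∀

m+m≡m*2 : ∀ m → m + m ≡ m * 2
m+m≡m*2 = solve-∀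

m+n<m*2 : ∀ {m n} → n < m → m + n < m * 2
m+n<m*2 {m} n<m = <-≤-trans (+-monoʳ-< m n<m) (≤-reflexive (m+m≡m*2 m))

m≤⌊n/2⌋⇒m*2≤n : ∀ {m n} → m ≤ ⌊ n /2⌋ → m * 2 ≤ n
m≤⌊n/2⌋⇒m*2≤n {zero}                  _         = z≤n
m≤⌊n/2⌋⇒m*2≤n {suc m} {suc (suc n)} (s≤s m≤n) = s≤s (s≤s (m≤⌊n/2⌋⇒m*2≤n m≤n))

⌊n/2⌋<m⇒n<m*2 : ∀ {m n} → ⌊ n /2⌋ < m → n < m * 2
⌊n/2⌋<m⇒n<m*2 {suc m} {zero}        _                 = z<s
⌊n/2⌋<m⇒n<m*2 {suc m} {suc zero}    _                 = s<s z<s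
⌊n/2⌋<m⇒n<m*2 {suc m} {suc (suc n)} (s≤s ⌊n/2⌋<m) = s<s (s<s (⌊n/2⌋<m⇒n<m*2 ⌊n/2⌋<m))

V[2,2m+1] : ∀ m → V 2 (suc (m * 2)) ≡ m + ⌊ m /2⌋
V[2,2m+1] m = begin
  V 2 n
    ≡⟨ V≡odd-rows+even-rows 2 m (Bézout⇒coprime 1 m (bézout m)) ⟩
  ∑[ j < m ] visibleRow 2 n (suc (j * 2)) + ∑[ j < m ] visibleRow 2 n (suc j * 2)
    ≡⟨ cong₂ _+_ (∑-ones m (λ _ → odd-row))
                 (∑-prefix m _ ⌊ m /2⌋ (⌊n/2⌋≤n m) (λ _ → low-even-row) (λ _ → high-even-row)) ⟩
  m + ⌊ m /2⌋ ∎
  where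
  open ≡-Reasoning
  n = suc (m * 2)
  bézout : ∀ m → suc (m * 2) * 1 ≡ 2 * m + 1
  bézout = solve-∀
  2y/n<2 : ∀ {y} → y < n → 2 * y / n < 2
  2y/n<2 y<n = m<n*o⇒m/o<n (*-monoʳ-< 2 y<n)
  coprime-to-odd : ∀ q j → q < 2 → Coprime (suc q) (suc (j * 2))
  coprime-to-odd zero       j _ = 1-coprimeTo _
  coprime-to-odd (suc zero) j _ = Bézout⇒coprime (suc j) 1 (bézout′ j)
    where
    bézout′ : ∀ j → 2 * suc j ≡ suc (j * 2) * 1 + 1
    bézout′ = solve-∀
  coprime-to-odd (suc (suc q)) j (s≤s (s≤s ()))
  odd-row : ∀ {j} → j < m → visibleRow 2 n (suc (j * 2)) ≡ 1
  odd-row {j} j<m = indicator-yes _ (coprime-to-odd _ j (2y/n<2 (s<s (*-monoˡ-< 2 j<m))))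
  low-even-row : ∀ {j} → j < ⌊ m /2⌋ → visibleRow 2 n (suc j * 2) ≡ 1
  low-even-row {j} j<⌊m/2⌋ = trans
    (visibleRow-by-division {2} 0 (2 * (suc j * 2)) (sym (+-identityʳ _)) 2y<n)
    (indicator-yes _ (1-coprimeTo _))
    where
    2y<n : 2 * (suc j * 2) < n
    2y<n = s≤s (≤-trans (*-monoʳ-≤ 2 (m≤⌊n/2⌋⇒m*2≤n j<⌊m/2⌋)) (≤-reflexive (*-comm 2 m)))
  high-even-row : ∀ {j} → ⌊ m /2⌋ ≤ j → j < m → visibleRow 2 n (suc j * 2) ≡ 0
  high-even-row {j} ⌊m/2⌋≤j j<m = trans
    (visibleRow-by-quotient {2} {n} (≤-antisym (s≤s⁻¹ (2y/n<2 y<n)) (m≥n⇒m/n>0 n≤2y)))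
    (indicator-no _ (common-factor⇒¬coprime (s<s z<s) ∣-refl (n∣m*n (suc j))))
    where
    y = suc j * 2
    y<n : y < n
    y<n = s≤s (*-monoˡ-≤ 2 j<m)
    n≤2y : n ≤ 2 * y
    n≤2y = ≤-trans (*-monoˡ-< 2 (⌊n/2⌋<m⇒n<m*2 (s≤s ⌊m/2⌋≤j))) (≤-reflexive (*-comm y 2))

V[m+1,2m+1] : ∀ m → V (suc m) (suc (m * 2)) ≡ m + ⌊ m /2⌋
V[m+1,2m+1] m = begin
  V (suc m) n
    ≡⟨ V≡odd-rows+even-rows (suc m) m (coprime-sym (Bézout⇒coprime 2 1 (bézout m))) ⟩
  ∑[ j < m ] visibleRow (suc m) n (suc (j * 2)) + ∑[ j < m ] visibleRow (suc m) n (suc j * 2)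
    ≡⟨ cong₂ _+_ (∑-ones m (λ _ → odd-row)) (∑-alternating m _ even-even-row odd-even-row) ⟩
  m + ⌊ m /2⌋ ∎
  where
  open ≡-Reasoning
  n = suc (m * 2)
  bézout : ∀ m → suc m * 2 ≡ suc (m * 2) * 1 + 1
  bézout = solve-∀
  odd-row : ∀ {j} → j < m → visibleRow (suc m) n (suc (j * 2)) ≡ 1
  odd-row {j} j<m = trans
    (visibleRow-by-division {suc m} j (suc m + j) (division m j) (s<s (m+n<m*2 j<m)))
    (indicator-yes _ (coprime[1+j,1+2j] j))
    where
    division : ∀ m j → suc m * suc (j * 2) ≡ (suc m + j) + j * suc (m * 2)
    division = solve-∀
  even-row : ∀ {j} → j < m → visibleRow (suc m) n (suc j * 2) ≡ indicator (coprime? (suc (suc j)) (suc j * 2))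
  even-row {j} j<m =
    visibleRow-by-division {suc m} (suc j) (suc j) (division m j) (s<s (≤-trans j<m (m≤m*n m 2)))
    where
    division : ∀ m j → suc m * (suc j * 2) ≡ suc j + suc j * suc (m * 2)
    division = solve-∀
  even-even-row : ∀ i → i * 2 < m → visibleRow (suc m) n (suc (i * 2) * 2) ≡ 0
  even-even-row i lt = trans (even-row lt)
    (indicator-no _ (common-factor⇒¬coprime (s<s z<s) (n∣m*n (suc i)) (n∣m*n (suc (i * 2)))))
  odd-even-row : ∀ i → suc (i * 2) < m → visibleRow (suc m) n (suc (suc (i * 2)) * 2) ≡ 1
  odd-even-row i lt = trans (even-row lt)
    (indicator-yes _ (coprime-sym (Bézout⇒coprime (suc i) (suc (i * 2)) (bézout′ i))))
    where
    bézout′ : ∀ i → suc (suc (i * 2)) * 2 * suc i ≡ suc (suc (suc (i * 2))) * suc (i * 2) + 1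
    bézout′ = solve-∀

V[m,2m+1] : ∀ m → 0 < m → V m (suc (m * 2)) ≡ m + 1
V[m,2m+1] m 0<m = begin
  V m n
    ≡⟨ V≡odd-rows+even-rows m m (Bézout⇒coprime 1 2 (bézout m)) ⟩
  ∑[ j < m ] visibleRow m n (suc (j * 2)) + ∑[ j < m ] visibleRow m n (suc j * 2)
    ≡⟨ cong₂ _+_ (∑-ones m (λ _ → odd-row)) (∑-single m _ 0 0<m (λ _ → non-first-even-row)) ⟩
  m + visibleRow m n 2
    ≡⟨ cong (m +_) (trans (even-row {0} 0<m) (indicator-yes (coprime? 1 2) (1-coprimeTo 2))) ⟩
  m + 1 ∎
  where
  open ≡-Reasoning
  n = suc (m * 2)
  bézout : ∀ m → suc (m * 2) * 1 ≡ m * 2 + 1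
  bézout = solve-∀
  odd-row : ∀ {j} → j < m → visibleRow m n (suc (j * 2)) ≡ 1
  odd-row {j} j<m with m≤n⇒∃[o]m+o≡n j<m
  ... | e , refl = trans
    (visibleRow-by-division {suc (j + e)} j (suc e) (division j e)
                            (s≤s (≤-trans (s≤s (m≤n+m e j)) (m≤m*n _ 2))))
    (indicator-yes _ (coprime[1+j,1+2j] j))
    where
    division : ∀ j e → suc (j + e) * suc (j * 2) ≡ suc e + j * suc (suc (j + e) * 2)
    division = solve-∀
  even-row : ∀ {j} → j < m → visibleRow m n (suc j * 2) ≡ indicator (coprime? (suc j) (suc j * 2))
  even-row {j} j<m with m≤n⇒∃[o]m+o≡n j<m
  ... | e , refl =
    visibleRow-by-division {suc (j + e)} j (suc (suc (j + e) + e)) (division j e) (s<s (m+n<m*2 (s≤s (m≤n+m e j))))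
    where
    division : ∀ j e → suc (j + e) * (suc j * 2) ≡ suc (suc (j + e) + e) + j * suc (suc (j + e) * 2)
    division = solve-∀
  non-first-even-row : ∀ {j} → j < m → j ≢ 0 → visibleRow m n (suc j * 2) ≡ 0
  non-first-even-row {zero}  _   0≢0 = contradiction refl 0≢0
  non-first-even-row {suc i} j<m _   =
    trans (even-row j<m) (indicator-no _ (common-factor⇒¬coprime (s<s z<s) ∣-refl (m∣m*n 2)))

V[2p+1,2p+3] : ∀ p → V (suc (p * 2)) (suc (suc p * 2)) ≡ suc p + 1
V[2p+1,2p+3] p = begin
  V a n
    ≡⟨ V≡∑visibleRow a (suc p * 2) (coprime-sym (Bézout⇒coprime (suc p) p (bézout p))) ⟩
  ∑[ y < suc p * 2 ] visibleRow a n (suc y)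
    ≡⟨ cong (λ k → ∑ k (visibleRow a n ∘ suc)) (m+m≡m*2 (suc p)) ⟨
  ∑[ y < suc p + suc p ] visibleRow a n (suc y)
    ≡⟨ ∑-split (suc p) (suc p) (visibleRow a n ∘ suc) ⟩
  ∑[ i < suc p ] visibleRow a n (suc i) + ∑[ t < suc p ] visibleRow a n (suc (suc p + t))
    ≡⟨ cong₂ _+_ (∑-single (suc p) _ 0 z<s (λ _ → non-first-lower-row))
                 (∑-ones (suc p) (λ _ → upper-row)) ⟩
  visibleRow a n 1 + suc p
    ≡⟨ cong (_+ suc p) (lower-row {0} z<s) ⟩
  1 + suc p
    ≡⟨ +-comm 1 (suc p) ⟩
  suc p + 1 ∎
  where
  open ≡-Reasoning
  a = suc (p * 2)
  n = suc (suc p * 2)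
  bézout : ∀ p → suc (p * 2) * suc p ≡ suc (suc p * 2) * p + 1
  bézout = solve-∀
  lower-row : ∀ {i} → i < suc p → visibleRow a n (suc i) ≡ indicator (coprime? (suc i) (suc i))
  lower-row {i} i<1+p with m≤n⇒∃[o]m+o≡n (s≤s⁻¹ i<1+p)
  ... | e , refl = visibleRow-by-division {suc ((i + e) * 2)} i (suc (e * 2)) (division i e)
                     (s≤s (s≤s (≤-trans (*-monoˡ-≤ 2 (m≤n+m e i)) (n≤1+n _))))
    where
    division : ∀ i e → suc ((i + e) * 2) * suc i ≡ suc (e * 2) + i * suc (suc (i + e) * 2)
    division = solve-∀
  non-first-lower-row : ∀ {i} → i < suc p → i ≢ 0 → visibleRow a n (suc i) ≡ 0
  non-first-lower-row {zero}  _     0≢0 = contradiction refl 0≢0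
  non-first-lower-row {suc i} i<1+p _   =
    trans (lower-row i<1+p) (indicator-no _ (common-factor⇒¬coprime (s<s z<s) ∣-refl ∣-refl))
  upper-row : ∀ {t} → t < suc p → visibleRow a n (suc (suc p + t)) ≡ 1
  upper-row {t} t<1+p with m≤n⇒∃[o]m+o≡n (s≤s⁻¹ t<1+p)
  ... | e , refl = trans
    (visibleRow-by-division {suc ((t + e) * 2)} (t + e + t) (suc e * 2) (division t e)
                            (s≤s (s≤s (s≤s (*-monoˡ-≤ 2 (m≤n+m e t))))))
    (indicator-yes _ (coprime-sym (Bézout⇒coprime 1 1 (consecutive (suc (t + e + t))))))
    where
    division : ∀ t e → suc ((t + e) * 2) * suc (suc (t + e) + t)
                     ≡ suc e * 2 + (t + e + t) * suc (suc (t + e) * 2)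
    division = solve-∀
    consecutive : ∀ x → suc x * 1 ≡ x * 1 + 1
    consecutive = solve-∀

data ParityView : ℕ → Set where
  even : ∀ k → ParityView (k * 2)
  odd  : ∀ k → ParityView (suc (k * 2))

parityView : ∀ m → ParityView m
parityView zero = even 0
parityView (suc m) with parityView m
... | even k = odd k
... | odd k  = even (suc k)

⌊m*2/2⌋≡m : ∀ m → ⌊ m * 2 /2⌋ ≡ m
⌊m*2/2⌋≡m zero    = refl
⌊m*2/2⌋≡m (suc m) = cong suc (⌊m*2/2⌋≡m m)

⌊1+m*2/2⌋≡m : ∀ m → ⌊ suc (m * 2) /2⌋ ≡ m
⌊1+m*2/2⌋≡m zero    = refl
⌊1+m*2/2⌋≡m (suc m) = cong suc (⌊1+m*2/2⌋≡m m)

m≡r+q*d⇒[m∸r]/d≡q : ∀ {m} r q d .{{_ : NonZero d}} → m ≡ r + q * d → (m ∸ r) / d ≡ q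
m≡r+q*d⇒[m∸r]/d≡q r q d refl = trans (/-congˡ {o = d} (m+n∸m≡n r (q * d))) (m*n/n≡m q d)

m≡r+q*d⇒m%d≡r%d : ∀ {m} r q d .{{_ : NonZero d}} → m ≡ r + q * d → m % d ≡ r % d
m≡r+q*d⇒m%d≡r%d r q d refl = [m+kn]%n≡m%n r q d

V[2,2m+1]-mod4 : ∀ m → let n = suc (m * 2) in
                 (n % 4 ≡ 1 → V 2 n ≡ (3 * n ∸ 3) / 4) × (n % 4 ≡ 3 → V 2 n ≡ (3 * n ∸ 5) / 4)
V[2,2m+1]-mod4 m with parityView m
... | even k = (λ _ → value) , (λ n%4≡3 → contradiction (trans (sym n%4≡1) n%4≡3) λ ())
  where
  n%4≡1 : suc (k * 2 * 2) % 4 ≡ 1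
  n%4≡1 = m≡r+q*d⇒m%d≡r%d 1 k 4 (n≡1+k*4 k)
    where
    n≡1+k*4 : ∀ k → suc (k * 2 * 2) ≡ 1 + k * 4
    n≡1+k*4 = solve-∀
  value : V 2 (suc (k * 2 * 2)) ≡ (3 * suc (k * 2 * 2) ∸ 3) / 4
  value = begin
    V 2 (suc (k * 2 * 2))               ≡⟨ V[2,2m+1] (k * 2) ⟩
    k * 2 + ⌊ k * 2 /2⌋                 ≡⟨ cong (k * 2 +_) (⌊m*2/2⌋≡m k) ⟩
    k * 2 + k                           ≡⟨ m≡r+q*d⇒[m∸r]/d≡q 3 (k * 2 + k) 4 (3n≡3+[2k+k]*4 k) ⟨
    (3 * suc (k * 2 * 2) ∸ 3) / 4       ∎
    where
    open ≡-Reasoning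
    3n≡3+[2k+k]*4 : ∀ k → 3 * suc (k * 2 * 2) ≡ 3 + (k * 2 + k) * 4
    3n≡3+[2k+k]*4 = solve-∀
... | odd k = (λ n%4≡1 → contradiction (trans (sym n%4≡3) n%4≡1) λ ()) , (λ _ → value)
  where
  n%4≡3 : suc (suc (k * 2) * 2) % 4 ≡ 3
  n%4≡3 = m≡r+q*d⇒m%d≡r%d 3 k 4 (n≡3+k*4 k)
    where
    n≡3+k*4 : ∀ k → suc (suc (k * 2) * 2) ≡ 3 + k * 4
    n≡3+k*4 = solve-∀
  value : V 2 (suc (suc (k * 2) * 2)) ≡ (3 * suc (suc (k * 2) * 2) ∸ 5) / 4
  value = begin
    V 2 (suc (suc (k * 2) * 2))          ≡⟨ V[2,2m+1] (suc (k * 2)) ⟩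
    suc (k * 2) + ⌊ suc (k * 2) /2⌋      ≡⟨ cong (suc (k * 2) +_) (⌊1+m*2/2⌋≡m k) ⟩
    suc (k * 2) + k                      ≡⟨ m≡r+q*d⇒[m∸r]/d≡q 5 (suc (k * 2) + k) 4 (3n≡5+[2k+1+k]*4 k) ⟨
    (3 * suc (suc (k * 2) * 2) ∸ 5) / 4  ∎
    where
    open ≡-Reasoning
    3n≡5+[2k+1+k]*4 : ∀ k → 3 * suc (suc (k * 2) * 2) ≡ 5 + (suc (k * 2) + k) * 4
    3n≡5+[2k+1+k]*4 = solve-∀

n%2≡1⇒n≡1+[n/2]*2 : ∀ n → n % 2 ≡ 1 → n ≡ suc (n / 2 * 2)
n%2≡1⇒n≡1+[n/2]*2 n n%2≡1 = trans (m≡m%n+[m/n]*n n 2) (cong (_+ n / 2 * 2) n%2≡1)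

[n+1]/2≡1+m : ∀ m → (suc (m * 2) + 1) / 2 ≡ suc m
[n+1]/2≡1+m m = trans (/-congˡ {o = 2} (+-comm (suc (m * 2)) 1)) (m*n/n≡m (suc m) 2)

theorem7 : (n : ℕ) → 3 ≤ n → n % 2 ≡ 1 →
    (V 2 n ≡ V ((n + 1) / 2) n)
    × (n % 4 ≡ 1 → V 2 n ≡ (3 * n ∸ 3) / 4)
    × (n % 4 ≡ 3 → V 2 n ≡ (3 * n ∸ 5) / 4)
    × (V ((n ∸ 1) / 2) n ≡ (n + 1) / 2)
    × (V (n ∸ 2) n ≡ (n + 1) / 2)
theorem7 n 3≤n n%2≡1 with n / 2 | n%2≡1⇒n≡1+[n/2]*2 n n%2≡1
... | zero  | refl = contradiction 3≤n λ { (s≤s ()) }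
... | suc p | refl =
    trans (V[2,2m+1] m) (trans (sym (V[m+1,2m+1] m)) (cong (λ a → V a (suc (m * 2))) (sym ([n+1]/2≡1+m m))))
  , proj₁ (V[2,2m+1]-mod4 m)
  , proj₂ (V[2,2m+1]-mod4 m)
  , trans (cong (λ a → V a (suc (m * 2))) (m*n/n≡m m 2)) (trans (V[m,2m+1] m z<s) m+1≡[n+1]/2)
  , trans (V[2p+1,2p+3] p) m+1≡[n+1]/2
  where
  m = suc p
  m+1≡[n+1]/2 : m + 1 ≡ (suc (m * 2) + 1) / 2
  m+1≡[n+1]/2 = trans (+-comm m 1) (sym ([n+1]/2≡1+m m))
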